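{- Let $\mathcal{A}$ be a non-empty algebra in $\mathcal{C}$. (1) Every prime congruence of $\mathcal{A}$ has CBLP. (2) Every maximal congruence of $\mathcal{A}$ has CBLP.
   Context: $\mathcal{C}$ is an equational class of congruence-distributive algebras of some signature, such that every non-empty algebra $\mathcal{A}$ in $\mathcal{C}$ satisfies (H): $\nabla_{\mathcal{A}}=A^2$ is compact in the congruence lattice ${\rm Con}(\mathcal{A})$. A proper congruence $\phi$ is prime iff $\theta_1\cap\theta_2\subseteq\phi$ implies $\theta_1\subseteq\phi$ or $\theta_2\subseteq\phi$ for all congruences $\theta_1,\theta_2$; maximal congruences are the maximal proper congruences. $\mathcal{B}(L)$ denotes the Boolean center of a bounded distributive lattice $L$. For $\theta\in{\rm Con}(\mathcal{A})$, $u_\theta:{\rm Con}(\mathcal{A})\to{\rm Con}(\mathcal{A}/\theta)$, $u_\theta(\alpha)=(\alpha\vee\theta)/\theta$ (with $\phi/\theta=\{(a/\theta,b/\theta)\mid(a,b)\in\phi\}$); $\theta$ has CBLP iff the restriction of $u_\theta$ from $\mathcal{B}({\rm Con}(\mathcal{A}))$ to $\mathcal{B}({\rm Con}(\mathcal{A}/\theta))$ is surjective. -}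

module Defs where

open import Level using (Level; _⊔_; Lift; lift) renaming (suc to lsuc; zero to lzero)
open import Data.Nat using (ℕ)
open import Data.Fin using (Fin)
open import Data.Unit using (⊤; tt)
open import Data.Product using (Σ; ∃; _×_; _,_; proj₁; proj₂)
open import Data.Sum using (_⊎_)
open import Data.List using (List)
open import Data.List.Relation.Unary.All using (All)
open import Relation.Binary using (Rel; IsEquivalence)
open import Relation.Nullary using (¬_)

record Signature : Set₁ where
  field
    Op    : Set
    arity : Op → ℕ

module _ (Sg : Signature) where
  open Signature Sg

  data Term : Set where
    var : ℕ → Term
    app : (f : Op) → (Fin (arity f) → Term) → Term

  -- An algebra: a carrier with an equality (setoid) and operations
  -- respecting it.  Quotients are modelled by changing the equality.
  record Algebra (ℓ : Level) : Set (lsuc ℓ) where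
    field
      Carrier       : Set ℓ
      _≈_           : Rel Carrier ℓ
      isEquivalence : IsEquivalence _≈_
      op            : (f : Op) → (Fin (arity f) → Carrier) → Carrier
      op-cong       : ∀ f {xs ys} → (∀ i → xs i ≈ ys i) → op f xs ≈ op f ys

  record Identities : Set₁ where
    field
      Idx : Set
      lhs : Idx → Term
      rhs : Idx → Term

module _ {Sg : Signature} {ℓ : Level} where
  open Signature Sg

  ⟦_⟧ : Term Sg → (A : Algebra Sg ℓ) → (ℕ → Algebra.Carrier A) → Algebra.Carrier A
  ⟦ var n ⟧    A ρ = ρ n
  ⟦ app f ts ⟧ A ρ = Algebra.op A f (λ i → ⟦ ts i ⟧ A ρ)

  Satisfies : Identities Sg → Algebra Sg ℓ → Set ℓ
  Satisfies E A = ∀ (i : Identities.Idx E) (ρ : ℕ → Algebra.Carrier A) →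
    Algebra._≈_ A (⟦ Identities.lhs E i ⟧ A ρ) (⟦ Identities.rhs E i ⟧ A ρ)

  NonEmpty : Algebra Sg ℓ → Set ℓ
  NonEmpty A = Algebra.Carrier A

  record Congruence (A : Algebra Sg ℓ) : Set (lsuc ℓ) where
    open Algebra A
    field
      rel        : Rel Carrier ℓ
      isEquiv    : IsEquivalence rel
      ≈⊆rel      : ∀ {x y} → x ≈ y → rel x y
      compatible : ∀ f {xs ys} → (∀ i → rel (xs i) (ys i)) → rel (op f xs) (op f ys)

  module _ {A : Algebra Sg ℓ} where
    open Algebra A
    open Congruence

    _⊆_ : Congruence A → Congruence A → Set ℓ
    α ⊆ β = ∀ x y → rel α x y → rel β x y

    _≐_ : Congruence A → Congruence A → Set ℓ
    α ≐ β = (α ⊆ β) × (β ⊆ α)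

    Δ : Congruence A
    rel Δ = _≈_
    isEquiv Δ = isEquivalence
    ≈⊆rel Δ p = p
    compatible Δ = op-cong

    ∇ : Congruence A
    rel ∇ _ _ = Lift ℓ ⊤
    isEquiv ∇ = record { refl = lift tt ; sym = λ _ → lift tt ; trans = λ _ _ → lift tt }
    ≈⊆rel ∇ _ = lift tt
    compatible ∇ _ _ = lift tt

    _∩_ : Congruence A → Congruence A → Congruence A
    rel (α ∩ β) x y = rel α x y × rel β x y
    isEquiv (α ∩ β) = record
      { refl  = IsEquivalence.refl (isEquiv α) , IsEquivalence.refl (isEquiv β)
      ; sym   = λ p → IsEquivalence.sym (isEquiv α) (proj₁ p) , IsEquivalence.sym (isEquiv β) (proj₂ p)
      ; trans = λ p q → IsEquivalence.trans (isEquiv α) (proj₁ p) (proj₁ q)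
                      , IsEquivalence.trans (isEquiv β) (proj₂ p) (proj₂ q) }
    ≈⊆rel (α ∩ β) p = ≈⊆rel α p , ≈⊆rel β p
    compatible (α ∩ β) f ps = compatible α f (λ i → proj₁ (ps i)) , compatible β f (λ i → proj₂ (ps i))

    IsJoin : Congruence A → Congruence A → Congruence A → Set (lsuc ℓ)
    IsJoin α β γ = (α ⊆ γ) × (β ⊆ γ) × (∀ δ → α ⊆ δ → β ⊆ δ → γ ⊆ δ)

    IsSup : (Congruence A → Set ℓ) → Congruence A → Set (lsuc ℓ)
    IsSup S γ = (∀ α → S α → α ⊆ γ) × (∀ δ → (∀ α → S α → α ⊆ δ) → γ ⊆ δ)

    IsFinJoin : List (Congruence A) → Congruence A → Set (lsuc ℓ)
    IsFinJoin αs γ = All (_⊆ γ) αs × (∀ δ → All (_⊆ δ) αs → γ ⊆ δ)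

    Boolean : Congruence A → Set (lsuc ℓ)
    Boolean α = Σ (Congruence A) λ γ → ((α ∩ γ) ≐ Δ) × IsJoin α γ ∇

    Proper : Congruence A → Set ℓ
    Proper φ = ¬ (φ ≐ ∇)

    Prime : Congruence A → Set (lsuc ℓ)
    Prime φ = Proper φ × (∀ θ₁ θ₂ → (θ₁ ∩ θ₂) ⊆ φ → (θ₁ ⊆ φ) ⊎ (θ₂ ⊆ φ))

    Maximal : Congruence A → Set (lsuc ℓ)
    Maximal φ = Proper φ × (∀ ψ → Proper ψ → φ ⊆ ψ → ψ ⊆ φ)

  CongruenceDistributive : Algebra Sg ℓ → Set (lsuc ℓ)
  CongruenceDistributive A = ∀ (α β γ δ ε : Congruence A) →
    IsJoin β γ δ → IsJoin (α ∩ β) (α ∩ γ) ε → (α ∩ δ) ≐ ε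

  NablaCompact : Algebra Sg ℓ → Set (lsuc ℓ)
  NablaCompact A = ∀ (S : Congruence A → Set ℓ) → IsSup S ∇ →
    Σ (List (Congruence A)) λ αs → All S αs × IsFinJoin αs ∇

  _/_ : (A : Algebra Sg ℓ) → Congruence A → Algebra Sg ℓ
  A / θ = record
    { Carrier = Algebra.Carrier A
    ; _≈_ = Congruence.rel θ
    ; isEquivalence = Congruence.isEquiv θ
    ; op = Algebra.op A
    ; op-cong = Congruence.compatible θ }

  -- a congruence of A/θ, viewed as a congruence of A (it contains θ)
  forget : {A : Algebra Sg ℓ} (θ : Congruence A) → Congruence (A / θ) → Congruence A
  forget {A} θ β = record
    { rel = Congruence.rel β
    ; isEquiv = Congruence.isEquiv β
    ; ≈⊆rel = λ p → Congruence.≈⊆rel β (Congruence.≈⊆rel θ p)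
    ; compatible = Congruence.compatible β }

  -- CBLP: u_θ restricted to Boolean centers is surjective, where
  -- u_θ(α) = (α ∨ θ)/θ, i.e. u_θ(α) = β iff β (as a relation on A) is
  -- the join of α and θ in Con(A).
  CBLP : {A : Algebra Sg ℓ} → Congruence A → Set (lsuc ℓ)
  CBLP {A} θ = ∀ (β : Congruence (A / θ)) → Boolean β →
    Σ (Congruence A) λ α → Boolean α × IsJoin α θ (forget θ β)

module Submission where

-- Call a congruence β of A/φ trivial when it is the bottom
-- Δ_{A/φ} (i.e. β ⊆ φ as a relation on A) or the top ∇_{A/φ}.  Both
-- trivial congruences lift along u_φ to Boolean congruences of A: the
-- bottom is u_φ(Δ_A) and the top is u_φ(∇_A), and Δ_A, ∇_A complement
-- each other.  Hence φ has CBLP as soon as the Boolean center of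
-- Con(A/φ) consists of trivial congruences only.
--   * If φ is prime, a complemented pair β, γ in Con(A/φ) has meet
--     Δ_{A/φ} = φ, so β ⊆ φ or γ ⊆ φ; in the second case γ ⊆ β and
--     β = β ∨ γ = ∇.  So B(Con(A/φ)) = {Δ, ∇}.
--   * If φ is maximal then, classically, every congruence of A/φ is
--     either ∇ or (by maximality of φ) equal to φ.
-- Neither argument needs congruence-distributivity or condition (H), so
-- the theorem is proved for an arbitrary algebra A.

open import Defs
open import Level using (Level; Lift; lift; lower) renaming (suc to lsuc)
open import Data.Product using (_×_; _,_; proj₁; proj₂; Σ)
open import Data.Sum using (_⊎_; inj₁; inj₂)
open import Data.Unit using (tt)
open import Relation.Nullary using (yes; no)
open import Axiom.ExcludedMiddle using (ExcludedMiddle)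

open Congruence

module _ {ℓ : Level} {Sg : Signature} {B : Algebra Sg ℓ} where

  Δ-boolean : Boolean (Δ {A = B})
  Δ-boolean = ∇ , ((λ _ _ p → proj₁ p) , (λ _ _ p → p , lift tt))
                , ((λ _ _ _ → lift tt) , (λ _ _ p → p) , (λ _ _ ∇⊆δ → ∇⊆δ))

  ∇-boolean : Boolean (∇ {A = B})
  ∇-boolean = Δ , ((λ _ _ p → proj₂ p) , (λ _ _ p → lift tt , p))
                , ((λ _ _ p → p) , (λ _ _ _ → lift tt) , (λ _ ∇⊆δ _ → ∇⊆δ))

  join-∇-absorbs : (β γ : Congruence B) → IsJoin β γ ∇ → γ ⊆ β →
                   ∀ x y → rel β x y
  join-∇-absorbs β γ (_ , _ , least) γ⊆β x y =
    least β (λ _ _ p → p) γ⊆β x y (lift tt)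

module _ {ℓ : Level} {Sg : Signature} {A : Algebra Sg ℓ} where

  Trivial : (φ : Congruence A) → Congruence (A / φ) → Set ℓ
  Trivial φ β = (forget φ β ⊆ φ) ⊎ (∀ x y → rel β x y)

  lift-trivial : (φ : Congruence A) (β : Congruence (A / φ)) → Trivial φ β →
                 Σ (Congruence A) λ α → Boolean α × IsJoin α φ (forget φ β)
  lift-trivial φ β (inj₁ β⊆φ) =
    Δ , Δ-boolean , ( (λ _ _ p → ≈⊆rel β (≈⊆rel φ p))
                    , (λ _ _ p → ≈⊆rel β p)
                    , (λ _ _ φ⊆δ x y p → φ⊆δ x y (β⊆φ x y p)) )
  lift-trivial φ β (inj₂ β-total) =
    ∇ , ∇-boolean , ( (λ x y _ → β-total x y)
                    , (λ _ _ p → ≈⊆rel β p)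
                    , (λ _ ∇⊆δ _ x y _ → ∇⊆δ x y (lift tt)) )

  trivial-center⇒CBLP : (φ : Congruence A) →
                        (∀ β → Boolean β → Trivial φ β) → CBLP φ
  trivial-center⇒CBLP φ trivial β β-boolean =
    lift-trivial φ β (trivial β β-boolean)

  prime⇒trivial-center : (φ : Congruence A) → Prime φ →
                         ∀ β → Boolean β → Trivial φ β
  prime⇒trivial-center φ (_ , prime) β (γ , (β∩γ⊆φ , _) , β∨γ=∇)
    with prime (forget φ β) (forget φ γ) β∩γ⊆φ
  ... | inj₁ β⊆φ = inj₁ β⊆φ
  ... | inj₂ γ⊆φ = inj₂ (join-∇-absorbs β γ β∨γ=∇ (λ x y p → ≈⊆rel β (γ⊆φ x y p)))

  maximal⇒trivial : ExcludedMiddle (lsuc ℓ) → (φ : Congruence A) → Maximal φ →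
                    ∀ β → Trivial φ β
  maximal⇒trivial lem φ (_ , maximal) β with lem {Lift (lsuc ℓ) (forget φ β ≐ ∇)}
  ... | yes β=∇ = inj₂ (λ x y → proj₂ (lower β=∇) x y (lift tt))
  ... | no β≠∇  = inj₁ (maximal (forget φ β) (λ β=∇ → β≠∇ (lift β=∇)) (λ _ _ p → ≈⊆rel β p))

proposition4p14 : {ℓ : Level} (Sg : Signature) (E : Identities Sg) →
    (∀ (B : Algebra Sg ℓ) → Satisfies E B → CongruenceDistributive B) →
    (∀ (B : Algebra Sg ℓ) → Satisfies E B → NonEmpty B → NablaCompact B) →
    (A : Algebra Sg ℓ) → Satisfies E A → NonEmpty A →
    ((φ : Congruence A) → Prime φ → CBLP φ)
    × (ExcludedMiddle (lsuc ℓ) → (φ : Congruence A) → Maximal φ → CBLP φ)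
proposition4p14 Sg E _ _ A _ _ =
    (λ φ φ-prime → trivial-center⇒CBLP φ (prime⇒trivial-center φ φ-prime))
  , (λ lem φ φ-maximal →
       trivial-center⇒CBLP φ (λ β _ → maximal⇒trivial lem φ φ-maximal β))
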